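{- For every $F:\{0,1\}^n\times\{0,1\}^n\to\{0,1\}$, $$\mathsf{NM}(F)\ge \log\Big(\mathsf{D}^{\rightarrow}(F)/\log \mathsf{D}^{\rightarrow}(F)\Big).$$
   Context: $\mathsf{D}^{\rightarrow}(F)$ is the deterministic one-way communication complexity of $F$: the minimum total number of bits Alice (holding $x$) must send to Bob (holding $y$), with no communication from Bob to Alice, so that Bob can output $F(x,y)$ for every $(x,y)$. $\mathsf{NM}(F)$: an $s$-bit memoryless protocol consists of functions $f_x:\{0,1\}^s\to\{0,1\}^s$ ($x\in\{0,1\}^n$) and $g_y:\{0,1\}^s\to\{0,1\}^s$ ($y\in\{0,1\}^n$); Alice first sends $f_x(0^s)$, thereafter whenever Bob receives $m$ he replies $g_y(m)$ and whenever Alice receives $m$ she replies $f_x(m)$; the protocol terminates as soon as a message $1^{s-1}b$ is sent, with output $b$; it computes $F$ if the output is $F(x,y)$ for all $(x,y)$. $\mathsf{NM}(F)$ is the least such $s$. -}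

module Defs where

open import Data.Bool using (Bool; true; false; if_then_else_)
open import Data.Nat using (ℕ; zero; suc; _<_; _≤_)
open import Data.Vec using (Vec; replicate; _∷ʳ_)
open import Data.Product using (Σ; _×_; ∃)
open import Data.Empty using (⊥)
open import Relation.Binary.PropositionalEquality using (_≡_)
open import Relation.Nullary using (¬_)

BitStr : ℕ → Set
BitStr k = Vec Bool k

BoolFun : ℕ → Set
BoolFun n = BitStr n → BitStr n → Bool

-- A c-bit one-way protocol: Alice sends enc x ∈ {0,1}^c, Bob outputs dec y (enc x).
record OneWayProtocol (n c : ℕ) : Set where
  field
    enc : BitStr n → BitStr c
    dec : BitStr n → BitStr c → Bool

OneWayComputes : ∀ {n c} → OneWayProtocol n c → BoolFun n → Set
OneWayComputes {n} P F =
  (x y : BitStr n) → OneWayProtocol.dec P y (OneWayProtocol.enc P x) ≡ F x y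

HasOneWay : ∀ {n} → BoolFun n → ℕ → Set
HasOneWay {n} F c = Σ (OneWayProtocol n c) λ P → OneWayComputes P F

IsOneWayCC : ∀ {n} → BoolFun n → ℕ → Set
IsOneWayCC F d = HasOneWay F d × (∀ c → c < d → ¬ HasOneWay F c)

record MemorylessProtocol (n s : ℕ) : Set where
  field
    f : BitStr n → BitStr s → BitStr s
    g : BitStr n → BitStr s → BitStr s

isEven : ℕ → Bool
isEven zero = true
isEven (suc k) = if isEven k then false else true

-- The k-th message sent (k = 0,1,2,…), ignoring termination:
-- m₀ = f_x(0^s); message k is Alice's iff k is even; the next message
-- is the other party's reply to it.
message : ∀ {n s} → MemorylessProtocol n s → BitStr n → BitStr n → ℕ → BitStr s
message {s = s} P x y zero = MemorylessProtocol.f P x (replicate s false)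
message P x y (suc k) =
  if isEven k
  then MemorylessProtocol.g P y (message P x y k)
  else MemorylessProtocol.f P x (message P x y k)

Terminal : ∀ {s} → BitStr s → Bool → Set
Terminal {zero} m b = ⊥
Terminal {suc t} m b = m ≡ (replicate t true ∷ʳ b)

RunsTo : ∀ {n s} → MemorylessProtocol n s → BitStr n → BitStr n → Bool → Set
RunsTo P x y b =
  ∃ λ k → Terminal (message P x y k) b
        × (∀ j → j < k → ∀ b' → ¬ Terminal (message P x y j) b')

MemorylessComputes : ∀ {n s} → MemorylessProtocol n s → BoolFun n → Set
MemorylessComputes {n} P F = (x y : BitStr n) → RunsTo P x y (F x y)

HasMemoryless : ∀ {n} → BoolFun n → ℕ → Set
HasMemoryless {n} F s = Σ (MemorylessProtocol n s) λ P → MemorylessComputes P F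

IsNM : ∀ {n} → BoolFun n → ℕ → Set
IsNM F s = HasMemoryless F s × (∀ s' → s' < s → ¬ HasMemoryless F s')

module Submission where

-- In a memoryless protocol Alice's whole behaviour is the function
-- f_x : {0,1}^s → {0,1}^s, which is described by its table of 2^s·s bits.
-- Given y and f_x, Bob can replay the entire run, so the output F(x,y)
-- depends on x only through this table.  Hence sending the table is a
-- one-way protocol: D→(F) ≤ 2^s·s for s = NM(F).  With d = D→(F) ≥ 2 this
-- yields 2^d ≤ d^(2^s), which is the claimed bound with logarithms removed.

open import Defs
open import Data.Nat using (ℕ; zero; suc; _+_; _*_; _^_; _≤_; _≤?_)
open import Data.Nat.Properties
  using (<-cmp; ≤-total; ≰⇒>; ≤-trans; ^-monoʳ-≤; ^-monoˡ-≤; ^-*-assoc; *-comm; +-identityʳ; module ≤-Reasoning)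
open import Data.Bool using (Bool; true; false)
open import Data.Bool.Properties using () renaming (_≟_ to _≟ᵇ_)
open import Data.Vec using (Vec; []; _∷_; _++_; map; concat; replicate)
open import Data.Vec.Properties using (++-injectiveˡ; ++-injectiveʳ; ≡-dec; ∷ʳ-injectiveʳ)
open import Data.Vec.Membership.Propositional using (_∈_)
open import Data.Vec.Membership.Propositional.Properties using (∈-map⁺; ∈-++⁺ˡ; ∈-++⁺ʳ)
open import Data.Vec.Relation.Unary.Any using (Any; here; there; any?; satisfied)
import Data.Vec.Relation.Unary.Any as Any
open import Data.Product using (_,_; proj₁)
open import Data.Sum using (inj₁; inj₂)
open import Data.Empty using (⊥-elim)
open import Relation.Nullary using (Dec; yes; no)
open import Relation.Binary using (tri<; tri≈; tri>)
open import Relation.Binary.PropositionalEquality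
  using (_≡_; refl; sym; trans; cong; subst)

#BitStr : ℕ → ℕ
#BitStr zero = 1
#BitStr (suc k) = #BitStr k + #BitStr k

#BitStr≡2^ : ∀ k → #BitStr k ≡ 2 ^ k
#BitStr≡2^ zero = refl
#BitStr≡2^ (suc k) rewrite #BitStr≡2^ k = cong (2 ^ k +_) (sym (+-identityʳ (2 ^ k)))

allBitStrs : ∀ k → Vec (BitStr k) (#BitStr k)
allBitStrs zero = [] ∷ []
allBitStrs (suc k) = map (true ∷_) (allBitStrs k) ++ map (false ∷_) (allBitStrs k)

∈-allBitStrs : ∀ k (v : BitStr k) → v ∈ allBitStrs k
∈-allBitStrs zero [] = here refl
∈-allBitStrs (suc k) (true ∷ v) = ∈-++⁺ˡ (∈-map⁺ (true ∷_) (∈-allBitStrs k v))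
∈-allBitStrs (suc k) (false ∷ v) =
  ∈-++⁺ʳ (map (true ∷_) (allBitStrs k)) (∈-map⁺ (false ∷_) (∈-allBitStrs k v))

table : ∀ {k t} → (BitStr k → BitStr t) → BitStr (#BitStr k * t)
table {k} h = concat (map h (allBitStrs k))

concat-map-injective : ∀ {A : Set} {t m} (h h' : A → BitStr t) (as : Vec A m) →
  concat (map h as) ≡ concat (map h' as) → ∀ {a} → a ∈ as → h a ≡ h' a
concat-map-injective h h' (b ∷ as) eq (here refl) = ++-injectiveˡ (h b) (h' b) eq
concat-map-injective h h' (b ∷ as) eq (there a∈) =
  concat-map-injective h h' as (++-injectiveʳ (h b) (h' b) eq) a∈

table-injective : ∀ {k t} (h h' : BitStr k → BitStr t) →
  table h ≡ table h' → ∀ v → h v ≡ h' v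
table-injective {k} h h' eq v = concat-map-injective h h' (allBitStrs k) eq (∈-allBitStrs k v)

-- One-way protocols from encodings.  If F(x,y) depends on x only through a
-- c-bit encoding enc x, then Alice may send enc x; Bob searches for some x'
-- with the same encoding and outputs F(x',y).
oneWay-from-encoding : ∀ {n c} (F : BoolFun n) (enc : BitStr n → BitStr c) →
  (∀ x x' y → enc x ≡ enc x' → F x y ≡ F x' y) → HasOneWay F c
oneWay-from-encoding {n} {c} F enc determines = record { enc = enc ; dec = decode } , correct
  where
  sameCode? : (m : BitStr c) → Dec (Any (λ x' → enc x' ≡ m) (allBitStrs n))
  sameCode? m = any? (λ x' → ≡-dec _≟ᵇ_ (enc x') m) (allBitStrs n)

  decode : BitStr n → BitStr c → Bool
  decode y m with sameCode? m
  ... | yes found = F (proj₁ (satisfied found)) y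
  ... | no _ = false

  correct : ∀ x y → decode y (enc x) ≡ F x y
  correct x y with sameCode? (enc x)
  ... | no none = ⊥-elim (none (Any.map (λ { refl → refl }) (∈-allBitStrs n x)))
  ... | yes found with satisfied found
  ...   | x' , same = determines x' x y same

module Run {n s : ℕ} (P : MemorylessProtocol n s) where
  open MemorylessProtocol P

  message-determined : ∀ x x' y → (∀ v → f x v ≡ f x' v) →
    ∀ k → message P x y k ≡ message P x' y k
  message-determined x x' y same zero = same _
  message-determined x x' y same (suc k) with isEven k
  ... | true = cong (g y) (message-determined x x' y same k)
  ... | false = trans (cong (f x) (message-determined x x' y same k)) (same _)

  terminal-output : ∀ {t} (m : BitStr t) {b b'} → Terminal m b → Terminal m b' → b ≡ b'
  terminal-output {zero} m () _
  terminal-output {suc t} m p q = ∷ʳ-injectiveʳ (replicate t true) (replicate t true) (trans (sym p) q)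

  -- Two runs with identical transcripts terminate at the same step, hence with
  -- the same output: the first terminating message of one run is also the
  -- first of the other.
  same-transcript-same-output : ∀ x x' y → (∀ k → message P x y k ≡ message P x' y k) →
    ∀ {b b'} → RunsTo P x y b → RunsTo P x' y b' → b ≡ b'
  same-transcript-same-output x x' y same {b} {b'} (k , T , before) (k' , T' , before')
    with <-cmp k k'
  ... | tri< k<k' _ _ = ⊥-elim (before' k k<k' b (subst (λ m → Terminal m b) (same k) T))
  ... | tri≈ _ refl _ = terminal-output (message P x y k) T (subst (λ m → Terminal m b') (sym (same k)) T')
  ... | tri> _ _ k'<k = ⊥-elim (before k' k'<k b' (subst (λ m → Terminal m b') (sym (same k')) T'))

-- Simulation: an s-bit memoryless protocol yields a one-way protocol in which
-- Alice sends the table of f_x, i.e. 2^s·s bits.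
oneWay-from-memoryless : ∀ {n s} (F : BoolFun n) → HasMemoryless F s → HasOneWay F (2 ^ s * s)
oneWay-from-memoryless {s = s} F (P , computes) =
  subst (λ c → HasOneWay F c) (cong (_* s) (#BitStr≡2^ s))
        (oneWay-from-encoding F (λ x → table (f x)) determines)
  where
  open MemorylessProtocol P
  open Run P

  determines : ∀ x x' y → table (f x) ≡ table (f x') → F x y ≡ F x' y
  determines x x' y eq =
    same-transcript-same-output x x' y
      (message-determined x x' y (table-injective (f x) (f x') eq))
      (computes x y) (computes x' y)

oneWayCC-minimal : ∀ {n} {F : BoolFun n} {d c} → IsOneWayCC F d → HasOneWay F c → d ≤ c
oneWayCC-minimal {d = d} {c} (_ , noneBelow) protocol with d ≤? c
... | yes d≤c = d≤c
... | no d≰c = ⊥-elim (noneBelow c (≰⇒> d≰c) protocol)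

-- Arithmetic core: d ≤ 2^s·s implies 2^d ≤ d^(2^s) when d ≥ 2
-- (split on whether d exceeds 2^s).
pow-bound : ∀ s d → 2 ≤ d → d ≤ 2 ^ s * s → 2 ^ d ≤ d ^ (2 ^ s)
pow-bound s d 2≤d d≤ with ≤-total (2 ^ s) d
... | inj₁ 2^s≤d = begin
  2 ^ d               ≤⟨ ^-monoʳ-≤ 2 d≤ ⟩
  2 ^ (2 ^ s * s)     ≡⟨ cong (2 ^_) (*-comm (2 ^ s) s) ⟩
  2 ^ (s * 2 ^ s)     ≡⟨ ^-*-assoc 2 s (2 ^ s) ⟨
  (2 ^ s) ^ (2 ^ s)   ≤⟨ ^-monoˡ-≤ (2 ^ s) 2^s≤d ⟩
  d ^ (2 ^ s)         ∎
  where open ≤-Reasoning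
... | inj₂ d≤2^s = begin
  2 ^ d               ≤⟨ ^-monoʳ-≤ 2 d≤2^s ⟩
  2 ^ (2 ^ s)         ≤⟨ ^-monoˡ-≤ (2 ^ s) 2≤d ⟩
  d ^ (2 ^ s)         ∎
  where open ≤-Reasoning

fact4p4 : (n : ℕ) (F : BoolFun n) (s d : ℕ) →
          IsNM F s → IsOneWayCC F d → 2 ≤ d →
          2 ^ d ≤ d ^ (2 ^ s)
fact4p4 n F s d (memoryless , _) oneWayCC 2≤d =
  pow-bound s d 2≤d (oneWayCC-minimal oneWayCC (oneWay-from-memoryless F memoryless))
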